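{- Let $P$ and $Q$ be ribbon graphs. Then (1) $\chi((P\oplus_n Q)^{E(Q)})=\chi((P\oplus_n Q)^{E(P)})=\chi(P)+\chi(Q)-2n$; (2) $\gamma((P\oplus Q)^{E(Q)})=\gamma((P\oplus Q)^{E(P)})=\gamma(P)+\gamma(Q)$; (3) $\gamma((P\oplus_n Q)^{E(Q)})=\gamma((P\oplus_n Q)^{E(P)})>\gamma(P)+\gamma(Q)$ when $n\ge2$.
   Context: A ribbon graph is a surface with boundary made of vertex discs and edge discs meeting in disjoint segments, each segment on the boundary of exactly one vertex and one edge, each edge containing exactly two segments; considered up to homeomorphism. $\chi$ of a ribbon graph is the Euler characteristic of the closed surface obtained by capping off its boundary components with discs (i.e. of the corresponding cellularly embedded graph: vertices minus edges plus faces). Euler genus $\gamma$: twice the genus if orientable, non-orientable genus otherwise, summed over components. $n$-sum: $P\oplus_n Q$ is a connected ribbon graph $G$ with non-trivial connected ribbon subgraphs $P,Q$, $G=P\cup Q$, $P\cap Q=\{v_1,\dots,v_n\}$; equivalently obtained from $P$ and $Q$ by identifying $n$ pairs of vertices so that incident edges do not intersect. $\oplus=\oplus_1$. Partial dual $G^A$: orient each edge boundary arbitrarily; the boundary components of the spanning ribbon subgraph $(V(G),A)$ meet the edges of $G$ in disjoint arcs; mark each such arc with an arrow in the direction of the edge's boundary orientation, labelled by the edge; $G^A$ is obtained by capping each marked boundary component with a vertex disc and, for each label $e$, attaching an edge disc along the two $e$-labelled arrows respecting directions. -}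

module Defs where

open import Data.Nat using (ℕ; zero; suc; _+_; _*_; _<_)
open import Data.Integer as ℤ using (ℤ; +_)
open import Data.Fin using (Fin; zero; suc; _≟_; _≤?_)
open import Data.Bool using (Bool; true; false; _∧_; _∨_; not; if_then_else_)
open import Data.List using (List; []; _∷_)
open import Data.Bool.ListAction using (any)
open import Data.Product using (Σ; ∃; _×_; _,_)
open import Relation.Nullary using (¬_)
open import Relation.Nullary.Decidable using (⌊_⌋)
open import Relation.Binary.PropositionalEquality using (_≡_; _≢_)
open import Function using (_∘_; _⇔_)

anyF : ∀ {m} → (Fin m → Bool) → Bool
anyF {zero}  p = false
anyF {suc m} p = p zero ∨ anyF (p ∘ suc)

allF : ∀ {m} → (Fin m → Bool) → Bool
allF {zero}  p = true
allF {suc m} p = p zero ∧ allF (p ∘ suc)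

countF : ∀ {m} → (Fin m → Bool) → ℕ
countF {zero}  p = 0
countF {suc m} p = (if p zero then 1 else 0) + countF (p ∘ suc)

iter : ∀ {A : Set} → ℕ → (A → A) → A → A
iter zero    f x = x
iter (suc k) f x = f (iter k f x)

-- one closure step: add every y with t y already in S for some generator t
-- (the generators are involutions, so this is closure under the generators)
step : ∀ {m} → List (Fin m → Fin m) → (Fin m → Bool) → (Fin m → Bool)
step gens S y = S y ∨ any (λ t → S (t y)) gens

reach : ∀ {m} → List (Fin m → Fin m) → ℕ → Fin m → (Fin m → Bool)
reach gens zero    x = λ y → ⌊ y ≟ x ⌋
reach gens (suc k) x = step gens (reach gens k x)

-- the orbit of x (m closure steps suffice on m points)
orbit : ∀ {m} → List (Fin m → Fin m) → Fin m → (Fin m → Bool)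
orbit {m} gens x = reach gens m x

isRoot : ∀ {m} → List (Fin m → Fin m) → Fin m → Bool
isRoot gens x = allF (λ y → not (orbit gens x y) ∨ ⌊ x ≤? y ⌋)

numOrbits : ∀ {m} → List (Fin m → Fin m) → ℕ
numOrbits gens = countF (isRoot gens)

-- Ribbon graphs as graph-encoded maps (gems) on a set of m flags.
-- τ₀ : vertex switch, τ₁ : edge switch (around a vertex), τ₂ : side switch.
-- vertices = ⟨τ₁,τ₂⟩-orbits, edges = ⟨τ₀,τ₂⟩-orbits, faces (boundary
-- components) = ⟨τ₀,τ₁⟩-orbits, components = ⟨τ₀,τ₁,τ₂⟩-orbits.

record Gem (m : ℕ) : Set where
  field
    τ₀ τ₁ τ₂ : Fin m → Fin m
open Gem public

record IsRibbon {m : ℕ} (G : Gem m) : Set where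
  field
    inv₀  : ∀ x → τ₀ G (τ₀ G x) ≡ x
    inv₁  : ∀ x → τ₁ G (τ₁ G x) ≡ x
    inv₂  : ∀ x → τ₂ G (τ₂ G x) ≡ x
    fpf₀  : ∀ x → τ₀ G x ≢ x
    fpf₁  : ∀ x → τ₁ G x ≢ x
    fpf₂  : ∀ x → τ₂ G x ≢ x
    comm₀₂ : ∀ x → τ₀ G (τ₂ G x) ≡ τ₂ G (τ₀ G x)
    fpf₀₂  : ∀ x → τ₀ G (τ₂ G x) ≢ x

#V #E #F #K : ∀ {m} → Gem m → ℕ
#V G = numOrbits (τ₁ G ∷ τ₂ G ∷ [])
#E G = numOrbits (τ₀ G ∷ τ₂ G ∷ [])
#F G = numOrbits (τ₀ G ∷ τ₁ G ∷ [])
#K G = numOrbits (τ₀ G ∷ τ₁ G ∷ τ₂ G ∷ [])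

χ : ∀ {m} → Gem m → ℤ
χ G = (+ #V G ℤ.- + #E G) ℤ.+ + #F G

-- Euler genus, summed over components: each component contributes 2 - χ
γ : ∀ {m} → Gem m → ℤ
γ G = + (2 * #K G) ℤ.- χ G

Connected : ∀ {m} → Gem m → Set
Connected G = #K G ≡ 1

-- Edge sets are flag predicates closed under τ₀ and τ₂.
-- Partial dual G^A: swap τ₀ and τ₂ on the flags of edges in A.

partialDual : ∀ {m} → Gem m → (Fin m → Bool) → Gem m
partialDual G A = record
  { τ₀ = λ x → if A x then τ₂ G x else τ₀ G x
  ; τ₁ = τ₁ G
  ; τ₂ = λ x → if A x then τ₀ G x else τ₂ G x
  }

-- P is (isomorphic to) the ribbon subgraph of G spanned by the edges whose
-- flags satisfy A (with the vertices incident to them), via the flag map ι.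

record IsSubgraph {p g : ℕ} (P : Gem p) (G : Gem g)
                  (A : Fin g → Bool) (ι : Fin p → Fin g) : Set where
  field
    injective : ∀ a b → ι a ≡ ι b → a ≡ b
    image     : ∀ x → A x ≡ true ⇔ ∃ λ a → ι a ≡ x
    comm₀     : ∀ a → ι (τ₀ P a) ≡ τ₀ G (ι a)
    comm₂     : ∀ a → ι (τ₂ P a) ≡ τ₂ G (ι a)
    -- τ₁ of the subgraph: next flag around the vertex skipping deleted edges
    comm₁     : ∀ a → Σ ℕ λ k →
                  (ι (τ₁ P a) ≡ iter k (τ₁ G ∘ τ₂ G) (τ₁ G (ι a)))
                  × (∀ j → j < k → A (iter j (τ₁ G ∘ τ₂ G) (τ₁ G (ι a))) ≡ false)

sharedVertices : ∀ {g} → Gem g → (Fin g → Bool) → ℕ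
sharedVertices G A =
  countF (λ x → isRoot vs x
               ∧ anyF (λ y → orbit vs x y ∧ A y)
               ∧ anyF (λ y → orbit vs x y ∧ not (A y)))
  where vs = τ₁ G ∷ τ₂ G ∷ []

-- G = P ⊕ₙ Q : G connected, G = P ∪ Q with P, Q non-trivial connected ribbon
-- subgraphs meeting in exactly n vertices (and no edges).
-- inP marks the flags of E(P); the flags of E(Q) are the rest.
record IsNSum {g p q : ℕ} (n : ℕ) (G : Gem g) (P : Gem p) (Q : Gem q)
              (inP : Fin g → Bool) : Set where
  field
    ribbonG  : IsRibbon G
    ribbonP  : IsRibbon P
    ribbonQ  : IsRibbon Q
    connG    : Connected G
    connP    : Connected P
    connQ    : Connected Q
    nontrivP : 0 < p
    nontrivQ : 0 < q
    closed₀  : ∀ x → inP (τ₀ G x) ≡ inP x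
    closed₂  : ∀ x → inP (τ₂ G x) ≡ inP x
    ιP       : Fin p → Fin g
    ιQ       : Fin q → Fin g
    subP     : IsSubgraph P G inP ιP
    subQ     : IsSubgraph Q G (not ∘ inP) ιQ
    shared   : sharedVertices G inP ≡ n

{-# OPTIONS --safe #-}
-- All counts are numbers of orbits of groups generated by involutions of the flags.  Partial
-- duality with respect to A = E(P) swaps τ₀ and τ₂ on the flags of A, so G^A has the edges and
-- the components of G.  Its vertices (⟨τ₁, τ₂^A⟩-orbits) are the boundary components of P
-- together with the vertices of G incident only with E(Q); symmetrically its faces are the
-- boundary components of Q together with the vertices incident only with E(P).  Since each of
-- v(P), v(Q) counts the n shared vertices plus the vertices exclusive to it, this gives
-- χ(G^A) = χ(P) + χ(Q) − 2n, and as G^A is connected, γ(G^A) = γ(P) + γ(Q) + 2(n − 1).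
module Submission where

open import Defs
open import Data.Nat as ℕ using (ℕ; zero; suc; _+_; _≤_; _<_; z≤n; s≤s)
import Data.Nat.Properties as ℕₚ
open import Data.Fin as Fin using (Fin; zero; suc; _≟_; _≤?_)
import Data.Fin.Properties as Finₚ
open import Data.Integer as ℤ using (ℤ; +_)
import Data.Integer.Properties as ℤₚ
open import Data.Integer.Tactic.RingSolver using (solve-∀)
open import Data.Bool using (Bool; true; false; not; _∧_; _∨_; if_then_else_)
open import Data.Bool.Properties
  using (∧-conicalˡ; ∧-conicalʳ; ∧-assoc; ∧-comm; ∧-zeroʳ; ∧-identityʳ;
         ∨-zeroʳ; ∨-inverseʳ; ∨-comm; not-¬; not-involutive; if-not; if-cong)
open import Data.List using (List; []; _∷_)
open import Data.Bool.ListAction using (any)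
open import Data.List.Membership.Propositional using (_∈_)
open import Data.List.Relation.Unary.Any using (here; there)
open import Data.Product using (∃; _×_; _,_; proj₁; proj₂)
open import Data.Sum using (_⊎_; inj₁; inj₂)
open import Data.Unit using (⊤)
open import Data.Empty using (⊥-elim)
open import Relation.Nullary using (yes; no)
open import Relation.Nullary.Decidable using (⌊_⌋)
open import Relation.Binary.PropositionalEquality
open import Function using (_∘_)
open import Function.Bundles using (Equivalence)

∨-trueˡ : ∀ {a} b → a ≡ true → a ∨ b ≡ true
∨-trueˡ b refl = refl

∨-trueʳ : ∀ a {b} → b ≡ true → a ∨ b ≡ true
∨-trueʳ a refl = ∨-zeroʳ a

∨-true⁻ : ∀ a {b} → a ∨ b ≡ true → a ≡ true ⊎ b ≡ true
∨-true⁻ true  _ = inj₁ refl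
∨-true⁻ false p = inj₂ p

bool-ext : ∀ {a b} → (a ≡ true → b ≡ true) → (b ≡ true → a ≡ true) → a ≡ b
bool-ext {true}          f _ = sym (f refl)
bool-ext {false} {true}  _ g = g refl
bool-ext {false} {false} _ _ = refl

⌊≟⌋-refl : ∀ {m} (x : Fin m) → ⌊ x ≟ x ⌋ ≡ true
⌊≟⌋-refl x with x ≟ x
... | yes _  = refl
... | no x≢x = ⊥-elim (x≢x refl)

⌊≟⌋-true⁻ : ∀ {m} {x y : Fin m} → ⌊ x ≟ y ⌋ ≡ true → x ≡ y
⌊≟⌋-true⁻ {x = x} {y} p with x ≟ y
... | yes x≡y = x≡y

⌊≟⌋-false : ∀ {m} {x y : Fin m} → x ≢ y → ⌊ x ≟ y ⌋ ≡ false
⌊≟⌋-false {x = x} {y} x≢y with x ≟ y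
... | yes x≡y = ⊥-elim (x≢y x≡y)
... | no _    = refl

⌊≟⌋-suc : ∀ {m} (x y : Fin m) → ⌊ suc x ≟ suc y ⌋ ≡ ⌊ x ≟ y ⌋
⌊≟⌋-suc x y with x ≟ y
... | yes _ = refl
... | no _  = refl

anyF⁻ : ∀ {m} (p : Fin m → Bool) → anyF p ≡ true → ∃ λ i → p i ≡ true
anyF⁻ {suc m} p h with ∨-true⁻ (p zero) h
... | inj₁ p0 = zero , p0
... | inj₂ ps = let (i , pi) = anyF⁻ (p ∘ suc) ps in suc i , pi

anyF-intro : ∀ {m} (p : Fin m → Bool) (i : Fin m) → p i ≡ true → anyF p ≡ true
anyF-intro p zero    pi = ∨-trueˡ _ pi
anyF-intro p (suc i) pi = ∨-trueʳ (p zero) (anyF-intro (p ∘ suc) i pi)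

anyF-cong : ∀ {m} {p q : Fin m → Bool} → (∀ i → p i ≡ q i) → anyF p ≡ anyF q
anyF-cong {zero}  _ = refl
anyF-cong {suc m} h = cong₂ _∨_ (h zero) (anyF-cong (h ∘ suc))

allF⁻ : ∀ {m} (p : Fin m → Bool) → allF p ≡ true → ∀ i → p i ≡ true
allF⁻ p h zero    = ∧-conicalˡ _ _ h
allF⁻ p h (suc i) = allF⁻ (p ∘ suc) (∧-conicalʳ (p zero) _ h) i

allF-intro : ∀ {m} (p : Fin m → Bool) → (∀ i → p i ≡ true) → allF p ≡ true
allF-intro {zero}  p h = refl
allF-intro {suc m} p h = cong₂ _∧_ (h zero) (allF-intro (p ∘ suc) (h ∘ suc))

allF-false⁻ : ∀ {m} (p : Fin m → Bool) → allF p ≡ false → ∃ λ i → p i ≡ false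
allF-false⁻ {suc m} p h with p zero in p0
... | false = zero , p0
... | true  = let (i , pi) = allF-false⁻ (p ∘ suc) h in suc i , pi

allF-cong : ∀ {m} {p q : Fin m → Bool} → (∀ i → p i ≡ q i) → allF p ≡ allF q
allF-cong {zero}  _ = refl
allF-cong {suc m} h = cong₂ _∧_ (h zero) (allF-cong (h ∘ suc))

countF-cong : ∀ {m} {p q : Fin m → Bool} → (∀ i → p i ≡ q i) → countF p ≡ countF q
countF-cong {zero}  _ = refl
countF-cong {suc m} h = cong₂ _+_ (cong (λ b → if b then 1 else 0) (h zero)) (countF-cong (h ∘ suc))

countF≤size : ∀ {m} (p : Fin m → Bool) → countF p ≤ m
countF≤size {zero}  p = z≤n
countF≤size {suc m} p with p zero
... | true  = s≤s (countF≤size (p ∘ suc))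
... | false = ℕₚ.m≤n⇒m≤1+n (countF≤size (p ∘ suc))

countF-split : ∀ {m} (p s : Fin m → Bool) →
  countF p ≡ countF (λ i → p i ∧ s i) + countF (λ i → p i ∧ not (s i))
countF-split {zero}  p s = refl
countF-split {suc m} p s with p zero | s zero | countF-split (p ∘ suc) (s ∘ suc)
... | true  | true  | ih = cong suc ih
... | true  | false | ih = trans (cong suc ih) (sym (ℕₚ.+-suc _ _))
... | false | _     | ih = ih

countF-remove : ∀ {m} (p : Fin m → Bool) (z : Fin m) → p z ≡ true →
  countF p ≡ suc (countF (λ i → p i ∧ not ⌊ i ≟ z ⌋))
countF-remove {suc m} p zero pz rewrite pz =
  cong suc (countF-cong λ i → sym (∧-identityʳ (p (suc i))))
countF-remove {suc m} p (suc z) pz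
  with p zero | trans (countF-remove (p ∘ suc) z pz)
                      (cong suc (countF-cong λ i → cong (λ b → p (suc i) ∧ not b) (sym (⌊≟⌋-suc i z))))
... | true  | ih = cong suc ih
... | false | ih = ih

countF-≤-injection : ∀ {p q} (f : Fin p → Bool) (g : Fin q → Bool)
  (h : ∀ x → f x ≡ true → Fin q) →
  (∀ x fx → g (h x fx) ≡ true) →
  (∀ x y fx fy → h x fx ≡ h y fy → x ≡ y) →
  countF f ≤ countF g
countF-≤-injection {zero}  f g h hg hinj = z≤n
countF-≤-injection {suc p} f g h hg hinj with f zero in f0
... | false = countF-≤-injection (f ∘ suc) g (h ∘ suc) (hg ∘ suc)
                (λ x y fx fy e → Finₚ.suc-injective (hinj (suc x) (suc y) fx fy e))
... | true  = subst (suc (countF (f ∘ suc)) ≤_) (sym (countF-remove g z (hg zero f0)))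
                (s≤s (countF-≤-injection (f ∘ suc) g′ (h ∘ suc) hg′
                  (λ x y fx fy e → Finₚ.suc-injective (hinj (suc x) (suc y) fx fy e))))
  where
  z  = h zero f0
  g′ = λ y → g y ∧ not ⌊ y ≟ z ⌋
  hg′ : ∀ x fx → g′ (h (suc x) fx) ≡ true
  hg′ x fx = cong₂ _∧_ (hg (suc x) fx)
               (cong not (⌊≟⌋-false λ e → Finₚ.0≢1+n (sym (hinj (suc x) zero fx f0 e))))

countF-<-superset : ∀ {m} (f f′ : Fin m → Bool) (y : Fin m) →
  (∀ z → f z ≡ true → f′ z ≡ true) → f′ y ≡ true → f y ≡ false →
  suc (countF f) ≤ countF f′
countF-<-superset f f′ y f⊆f′ f′y fy =
  subst (suc (countF f) ≤_) (sym (countF-remove f′ y f′y))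
    (s≤s (countF-≤-injection f _ (λ z _ → z)
      (λ z fz → cong₂ _∧_ (f⊆f′ z fz)
                  (cong not (⌊≟⌋-false λ z≡y → not-¬ (subst (λ w → f w ≡ true) z≡y fz) fy)))
      (λ _ _ _ _ e → e)))

least : ∀ {n} (p : Fin n → Bool) (x : Fin n) → p x ≡ true →
  ∃ λ r → p r ≡ true × (∀ y → p y ≡ true → r Fin.≤ y)
least p zero    px = zero , px , λ _ _ → z≤n
least p (suc x) px with p zero in p0
... | true  = zero , p0 , λ _ _ → z≤n
... | false = let (r , pr , r≤) = least (p ∘ suc) x px in suc r , pr , minimal r≤
  where
  minimal : ∀ {r} → (∀ y → p (suc y) ≡ true → r Fin.≤ y) → ∀ y → p y ≡ true → suc r Fin.≤ y
  minimal r≤ zero    py = ⊥-elim (not-¬ py p0)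
  minimal r≤ (suc y) py = s≤s (r≤ y py)

Involutions : ∀ {m} → List (Fin m → Fin m) → Set
Involutions gens = ∀ {t} → t ∈ gens → ∀ x → t (t x) ≡ x

involutions₂ : ∀ {m} {a b : Fin m → Fin m} →
  (∀ x → a (a x) ≡ x) → (∀ x → b (b x) ≡ x) → Involutions (a ∷ b ∷ [])
involutions₂ ia ib (here refl)         = ia
involutions₂ ia ib (there (here refl)) = ib

involutions₃ : ∀ {m} {a b c : Fin m → Fin m} →
  (∀ x → a (a x) ≡ x) → (∀ x → b (b x) ≡ x) → (∀ x → c (c x) ≡ x) →
  Involutions (a ∷ b ∷ c ∷ [])
involutions₃ ia ib ic (here refl)                 = ia
involutions₃ ia ib ic (there (here refl))         = ib
involutions₃ ia ib ic (there (there (here refl))) = ic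

meets : ∀ {m} → List (Fin m → Fin m) → (Fin m → Bool) → Fin m → Bool
meets gens A x = anyF (λ y → orbit gens x y ∧ A y)

any-gen⁻ : ∀ {m} (S : Fin m → Bool) (y : Fin m) (gens : List (Fin m → Fin m)) →
  any (λ t → S (t y)) gens ≡ true → ∃ λ t → t ∈ gens × S (t y) ≡ true
any-gen⁻ S y (t ∷ gens) h with ∨-true⁻ (S (t y)) h
... | inj₁ St = t , here refl , St
... | inj₂ Ss = let (t′ , t′∈ , St′) = any-gen⁻ S y gens Ss in t′ , there t′∈ , St′

any-gen-intro : ∀ {m} (S : Fin m → Bool) (y : Fin m) (gens : List (Fin m → Fin m)) {t} →
  t ∈ gens → S (t y) ≡ true → any (λ t → S (t y)) gens ≡ true
any-gen-intro S y (t ∷ gens) (here refl) St = ∨-trueˡ _ St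
any-gen-intro S y (t ∷ gens) (there t∈) St = ∨-trueʳ (S (t y)) (any-gen-intro S y gens t∈ St)

module Orbits {m} (gens : List (Fin m → Fin m)) (inv : Involutions gens) where

  reach-induction : (x : Fin m) (P : Fin m → Set) → P x →
    (∀ {t} → t ∈ gens → ∀ z → P z → P (t z)) →
    ∀ k y → reach gens k x y ≡ true → P y
  reach-induction x P Px closed zero    y h = subst P (sym (⌊≟⌋-true⁻ h)) Px
  reach-induction x P Px closed (suc k) y h with ∨-true⁻ (reach gens k x y) h
  ... | inj₁ r = reach-induction x P Px closed k y r
  ... | inj₂ r = let (t , t∈ , rt) = any-gen⁻ (reach gens k x) y gens r in
                 subst P (inv t∈ y) (closed t∈ (t y) (reach-induction x P Px closed k (t y) rt))

  reach-refl : ∀ k x → reach gens k x x ≡ true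
  reach-refl zero    x = ⌊≟⌋-refl x
  reach-refl (suc k) x = ∨-trueˡ _ (reach-refl k x)

  Stable : Fin m → ℕ → Set
  Stable x k = ∀ y → reach gens (suc k) x y ≡ true → reach gens k x y ≡ true

  stable-suc : ∀ x k → Stable x k → Stable x (suc k)
  stable-suc x k st y h with ∨-true⁻ (reach gens (suc k) x y) h
  ... | inj₁ r = r
  ... | inj₂ r = let (t , t∈ , rt) = any-gen⁻ (reach gens (suc k) x) y gens r in
                 ∨-trueʳ (reach gens k x y) (any-gen-intro (reach gens k x) y gens t∈ (st (t y) rt))

  stable-or-large : ∀ x k → Stable x k ⊎ suc k ≤ countF (reach gens k x)
  stable-or-large x zero =
    inj₂ (subst (1 ≤_) (sym (countF-remove (reach gens 0 x) x (reach-refl 0 x))) (s≤s z≤n))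
  stable-or-large x (suc k) with stable-or-large x k
  ... | inj₁ st    = inj₁ (stable-suc x k st)
  ... | inj₂ large with allF (λ y → not (reach gens (suc k) x y) ∨ reach gens k x y) in all
  ...   | true  = inj₁ (stable-suc x k λ y h → implication (allF⁻ _ all y) h)
    where
    implication : ∀ {a b} → not a ∨ b ≡ true → a ≡ true → b ≡ true
    implication {true} p refl = p
  ...   | false = let (y , fy) = allF-false⁻ _ all in
                  inj₂ (ℕₚ.≤-trans (s≤s large)
                    (countF-<-superset (reach gens k x) (reach gens (suc k) x) y
                      (λ _ → ∨-trueˡ _) (new fy) (old fy)))
    where
    new : ∀ {a b} → not a ∨ b ≡ false → a ≡ true
    new {true} _ = refl
    old : ∀ {a b} → not a ∨ b ≡ false → b ≡ false
    old {true} {false} _ = refl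

  orbit-stable : ∀ x → Stable x m
  orbit-stable x with stable-or-large x m
  ... | inj₁ st    = st
  ... | inj₂ large = ⊥-elim (ℕₚ.<-irrefl refl (ℕₚ.≤-trans large (countF≤size (reach gens m x))))

  orbit-refl : ∀ x → orbit gens x x ≡ true
  orbit-refl = reach-refl m

  orbit-step : ∀ {t} → t ∈ gens → ∀ x y → orbit gens x y ≡ true → orbit gens x (t y) ≡ true
  orbit-step {t} t∈ x y h =
    orbit-stable x (t y) (∨-trueʳ (orbit gens x (t y))
      (any-gen-intro (orbit gens x) (t y) gens t∈
        (subst (λ w → orbit gens x w ≡ true) (sym (inv t∈ y)) h)))

  orbit-induction : (x : Fin m) (P : Fin m → Set) → P x →
    (∀ {t} → t ∈ gens → ∀ z → P z → P (t z)) → ∀ y → orbit gens x y ≡ true → P y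
  orbit-induction x P Px closed = reach-induction x P Px closed m

  orbit-trans : ∀ x y z → orbit gens x y ≡ true → orbit gens y z ≡ true → orbit gens x z ≡ true
  orbit-trans x y z xy =
    orbit-induction y (λ w → orbit gens x w ≡ true) xy (λ t∈ w → orbit-step t∈ x w) z

  orbit-sym : ∀ x y → orbit gens x y ≡ true → orbit gens y x ≡ true
  orbit-sym x = orbit-induction x (λ w → orbit gens w x ≡ true) (orbit-refl x) back
    where
    back : ∀ {t} → t ∈ gens → ∀ w → orbit gens w x ≡ true → orbit gens (t w) x ≡ true
    back {t} t∈ w wx = orbit-trans (t w) w x
      (subst (λ v → orbit gens (t w) v ≡ true) (inv t∈ w)
        (orbit-step t∈ (t w) (t w) (orbit-refl (t w)))) wx

  root-≤ : ∀ x y → isRoot gens x ≡ true → orbit gens x y ≡ true → x Fin.≤ y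
  root-≤ x y rx xy = read (allF⁻ _ rx y) xy
    where
    read : ∀ {a} → not a ∨ ⌊ x ≤? y ⌋ ≡ true → a ≡ true → x Fin.≤ y
    read {true} p refl with x ≤? y
    ... | yes x≤y = x≤y

  root-unique : ∀ x y → isRoot gens x ≡ true → isRoot gens y ≡ true →
    orbit gens x y ≡ true → x ≡ y
  root-unique x y rx ry xy = Finₚ.≤-antisym (root-≤ x y rx xy) (root-≤ y x ry (orbit-sym x y xy))

  leastInOrbit : ∀ x → ∃ λ r → orbit gens x r ≡ true × isRoot gens r ≡ true
  leastInOrbit x with least (orbit gens x) x (orbit-refl x)
  ... | r , xr , r≤ = r , xr , allF-intro _ λ y → minimal y (orbit gens r y) refl
    where
    minimal : ∀ y b → orbit gens r y ≡ b → not b ∨ ⌊ r ≤? y ⌋ ≡ true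
    minimal y false _  = refl
    minimal y true  ry with r ≤? y
    ... | yes _   = refl
    ... | no  r≰y = ⊥-elim (r≰y (r≤ y (orbit-trans x r y xr ry)))

  root : Fin m → Fin m
  root x = proj₁ (leastInOrbit x)

  orbit-root : ∀ x → orbit gens x (root x) ≡ true
  orbit-root x = proj₁ (proj₂ (leastInOrbit x))

  isRoot-root : ∀ x → isRoot gens (root x) ≡ true
  isRoot-root x = proj₂ (proj₂ (leastInOrbit x))

  root-≡⇒orbit : ∀ x y → root x ≡ root y → orbit gens x y ≡ true
  root-≡⇒orbit x y e = orbit-trans x _ y (orbit-root x)
    (subst (λ w → orbit gens w y ≡ true) (sym e) (orbit-sym y _ (orbit-root y)))

  meets-intro : ∀ A x y → orbit gens x y ≡ true → A y ≡ true → meets gens A x ≡ true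
  meets-intro A x y xy Ay = anyF-intro _ y (cong₂ _∧_ xy Ay)

  meets⁻ : ∀ A x → meets gens A x ≡ true → ∃ λ y → orbit gens x y ≡ true × A y ≡ true
  meets⁻ A x h = let (y , q) = anyF⁻ _ h in y , ∧-conicalˡ _ _ q , ∧-conicalʳ _ _ q

  meets-invariant : ∀ A x y → orbit gens x y ≡ true → meets gens A x ≡ true → meets gens A y ≡ true
  meets-invariant A x y xy h = let (z , xz , Az) = meets⁻ A x h in
    meets-intro A y z (orbit-trans y x z (orbit-sym x y xy) xz) Az

  avoids : ∀ A x y → meets gens A x ≡ false → orbit gens x y ≡ true → A y ≡ false
  avoids A x y h xy with A y in Ay
  ... | false = refl
  ... | true  = ⊥-elim (not-¬ (meets-intro A x y xy Ay) h)

ActsWithin : ∀ {m} → (Fin m → Set) → List (Fin m → Fin m) → List (Fin m → Fin m) → Set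
ActsWithin P hs gs = ∀ {t} → t ∈ hs → ∀ y → P y → ∃ λ t′ → t′ ∈ gs × t y ≡ t′ y

ActsAsSomeOf : ∀ {m} → List (Fin m → Fin m) → List (Fin m → Fin m) → Set
ActsAsSomeOf = ActsWithin (λ _ → ⊤)

orbit-⊆ : ∀ {m} {P : Fin m → Set} {hs gs : List (Fin m → Fin m)} →
  Involutions hs → Involutions gs → ActsWithin P hs gs →
  ∀ x → (∀ y → orbit gs x y ≡ true → P y) →
  ∀ y → orbit hs x y ≡ true → orbit gs x y ≡ true
orbit-⊆ {P = P} {hs} {gs} invh invg within x inP =
  Orbits.orbit-induction hs invh x (λ y → orbit gs x y ≡ true) (Orbits.orbit-refl gs invg x) step′
  where
  step′ : ∀ {t} → t ∈ hs → ∀ z → orbit gs x z ≡ true → orbit gs x (t z) ≡ true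
  step′ t∈ z xz = let (t′ , t′∈ , tz≡t′z) = within t∈ z (inP z xz) in
    subst (λ w → orbit gs x w ≡ true) (sym tz≡t′z) (Orbits.orbit-step gs invg t′∈ x z xz)

orbit-≡-within : ∀ {m} {P : Fin m → Set} {gs hs : List (Fin m → Fin m)} →
  Involutions gs → Involutions hs → ActsWithin P gs hs → ActsWithin P hs gs →
  ∀ x → (∀ y → orbit gs x y ≡ true → P y) → ∀ y → orbit gs x y ≡ orbit hs x y
orbit-≡-within invg invh g⊆h h⊆g x inP y = bool-ext (orbit-⊆ invg invh g⊆h x inP′ y) h→g
  where
  h→g = orbit-⊆ invh invg h⊆g x inP y
  inP′ = λ z hz → inP z (orbit-⊆ invh invg h⊆g x inP z hz)

orbit-cong : ∀ {m} {gs hs : List (Fin m → Fin m)} → Involutions gs → Involutions hs →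
  ActsAsSomeOf gs hs → ActsAsSomeOf hs gs → ∀ x y → orbit gs x y ≡ orbit hs x y
orbit-cong invg invh g⊆h h⊆g x = orbit-≡-within invg invh g⊆h h⊆g x _

isRoot-cong : ∀ {m} {gs hs : List (Fin m → Fin m)} (x : Fin m) →
  (∀ y → orbit gs x y ≡ orbit hs x y) → isRoot gs x ≡ isRoot hs x
isRoot-cong x same = allF-cong λ y → cong (λ b → not b ∨ _) (same y)

numOrbits-cong : ∀ {m} {gs hs : List (Fin m → Fin m)} → Involutions gs → Involutions hs →
  ActsAsSomeOf gs hs → ActsAsSomeOf hs gs → numOrbits gs ≡ numOrbits hs
numOrbits-cong invg invh g⊆h h⊆g = countF-cong λ x → isRoot-cong x (orbit-cong invg invh g⊆h h⊆g x)

numOrbits-swap : ∀ {m} {a b : Fin m → Fin m} → (∀ x → a (a x) ≡ x) → (∀ x → b (b x) ≡ x) →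
  numOrbits (a ∷ b ∷ []) ≡ numOrbits (b ∷ a ∷ [])
numOrbits-swap ia ib = numOrbits-cong (involutions₂ ia ib) (involutions₂ ib ia) swap swap
  where
  swap : ∀ {m} {a b : Fin m → Fin m} → ActsAsSomeOf (a ∷ b ∷ []) (b ∷ a ∷ [])
  swap (here refl)         y _ = _ , there (here refl) , refl
  swap (there (here refl)) y _ = _ , here refl , refl

-- Orbits that avoid A only ever use generators at points outside A.
countF-avoiding-cong : ∀ {m} {gs hs : List (Fin m → Fin m)} → Involutions gs → Involutions hs →
  (A : Fin m → Bool) →
  ActsWithin (λ y → A y ≡ false) gs hs → ActsWithin (λ y → A y ≡ false) hs gs →
  countF (λ x → isRoot gs x ∧ not (meets gs A x)) ≡ countF (λ x → isRoot hs x ∧ not (meets hs A x))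
countF-avoiding-cong {gs = gs} {hs} invg invh A g⊆h h⊆g = countF-cong λ x → by-cases x _ refl _ refl
  where
  same-orbit : ∀ x → (∀ y → orbit gs x y ≡ orbit hs x y) →
    isRoot gs x ∧ not (meets gs A x) ≡ isRoot hs x ∧ not (meets hs A x)
  same-orbit x same = cong₂ (λ r b → r ∧ not b) (isRoot-cong x same)
                            (anyF-cong λ y → cong (_∧ A y) (same y))

  by-cases : ∀ x b → meets gs A x ≡ b → ∀ c → meets hs A x ≡ c →
    isRoot gs x ∧ not (meets gs A x) ≡ isRoot hs x ∧ not (meets hs A x)
  by-cases x false g-avoids _ _ =
    same-orbit x (orbit-≡-within invg invh g⊆h h⊆g x λ z → Orbits.avoids gs invg A x z g-avoids)
  by-cases x true  _ false h-avoids = same-orbit x λ y →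
    sym (orbit-≡-within invh invg h⊆g g⊆h x (λ z → Orbits.avoids hs invh A x z h-avoids) y)
  by-cases x true  g-meets true h-meets =
    trans (cong (λ b → isRoot gs x ∧ not b) g-meets)
      (trans (∧-zeroʳ _) (sym (trans (cong (λ b → isRoot hs x ∧ not b) h-meets) (∧-zeroʳ _))))

numOrbits-transport : ∀ {p g} {gP : List (Fin p → Fin p)} {gG : List (Fin g → Fin g)} →
  Involutions gP → Involutions gG → (ι : Fin p → Fin g) (S : Fin g → Bool) →
  (∀ a → S (ι a) ≡ true) →
  (∀ x → S x ≡ true → ∃ λ a → orbit gG x (ι a) ≡ true) →
  (∀ x y → orbit gG x y ≡ true → S x ≡ true → S y ≡ true) →
  (∀ a b → orbit gP a b ≡ orbit gG (ι a) (ι b)) →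
  numOrbits gP ≡ countF (λ x → isRoot gG x ∧ S x)
numOrbits-transport {gP = gP} {gG} invP invG ι S Sι cover S-invariant ι-orbit =
  ℕₚ.≤-antisym
    (countF-≤-injection _ _ (λ a _ → G.root (ι a)) rootG-ok rootG-injective)
    (countF-≤-injection _ _ rootP (λ x h → P.isRoot-root (preimage x h)) rootP-injective)
  where
  module P = Orbits gP invP
  module G = Orbits gG invG

  rootG-ok : ∀ a _ → isRoot gG (G.root (ι a)) ∧ S (G.root (ι a)) ≡ true
  rootG-ok a _ = cong₂ _∧_ (G.isRoot-root (ι a)) (S-invariant _ _ (G.orbit-root (ι a)) (Sι a))

  rootG-injective : ∀ a b ra rb → G.root (ι a) ≡ G.root (ι b) → a ≡ b
  rootG-injective a b ra rb e =
    P.root-unique a b ra rb (trans (ι-orbit a b) (G.root-≡⇒orbit (ι a) (ι b) e))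

  preimage : ∀ x → isRoot gG x ∧ S x ≡ true → Fin _
  preimage x h = proj₁ (cover x (∧-conicalʳ _ _ h))

  rootP : ∀ x → isRoot gG x ∧ S x ≡ true → Fin _
  rootP x h = P.root (preimage x h)

  rootP-injective : ∀ x y hx hy → rootP x hx ≡ rootP y hy → x ≡ y
  rootP-injective x y hx hy e =
    G.root-unique x y (∧-conicalˡ _ _ hx) (∧-conicalˡ _ _ hy)
      (G.orbit-trans x _ y (proj₂ (cover x _))
        (G.orbit-trans _ _ y (trans (sym (ι-orbit _ _)) (P.root-≡⇒orbit _ _ e))
          (G.orbit-sym y _ (proj₂ (cover y _)))))

-- A subgraph generator σP may skip a run of flags outside A; the detour σ, τ, σ, …, σ that
-- replaces it lies in one ⟨σ, ρ⟩-orbit because ρ agrees with τ outside A.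
module SkippingOrbits {g p} (σ ρ τ : Fin g → Fin g) (A : Fin g → Bool) (ι : Fin p → Fin g)
  (σP ρP : Fin p → Fin p) (skips : Fin p → ℕ)
  (invσ : ∀ x → σ (σ x) ≡ x) (invρ : ∀ x → ρ (ρ x) ≡ x) (invτ : ∀ x → τ (τ x) ≡ x)
  (invσP : ∀ a → σP (σP a) ≡ a) (invρP : ∀ a → ρP (ρP a) ≡ a)
  (ρ-outside : ∀ x → A x ≡ false → ρ x ≡ τ x)
  (A-τ : ∀ x → A (τ x) ≡ A x)
  (ι-in : ∀ a → A (ι a) ≡ true)
  (ι-injective : ∀ a b → ι a ≡ ι b → a ≡ b)
  (ι-ρ : ∀ a → ι (ρP a) ≡ ρ (ι a))
  (ι-σ : ∀ a → ι (σP a) ≡ iter (skips a) (σ ∘ τ) (σ (ι a)))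
  (skipped : ∀ a j → j < skips a → A (iter j (σ ∘ τ) (σ (ι a))) ≡ false)
  where

  gensG : List (Fin g → Fin g)
  gensG = σ ∷ ρ ∷ []

  gensP : List (Fin p → Fin p)
  gensP = σP ∷ ρP ∷ []

  invG : Involutions gensG
  invG = involutions₂ invσ invρ

  invP : Involutions gensP
  invP = involutions₂ invσP invρP

  module G = Orbits gensG invG
  module P = Orbits gensP invP

  run : Fin p → ℕ → Fin g
  run b j = iter j (σ ∘ τ) (σ (ι b))

  run-in-orbit : ∀ a b j → j ≤ skips b →
    orbit gensG (ι a) (ι b) ≡ true → orbit gensG (ι a) (run b j) ≡ true
  run-in-orbit a b zero    _    ab = G.orbit-step (here refl) _ _ ab
  run-in-orbit a b (suc j) j<sk ab =
    G.orbit-step (here refl) _ _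
      (subst (λ w → orbit gensG (ι a) w ≡ true) (ρ-outside _ (skipped b j j<sk))
        (G.orbit-step (there (here refl)) _ _ (run-in-orbit a b j (ℕₚ.<⇒≤ j<sk) ab)))

  orbit-ι⁺ : ∀ a b → orbit gensP a b ≡ true → orbit gensG (ι a) (ι b) ≡ true
  orbit-ι⁺ a = P.orbit-induction a (λ b → orbit gensG (ι a) (ι b) ≡ true) (G.orbit-refl _) step′
    where
    step′ : ∀ {t} → t ∈ gensP → ∀ b →
      orbit gensG (ι a) (ι b) ≡ true → orbit gensG (ι a) (ι (t b)) ≡ true
    step′ (here refl) b ab =
      subst (λ w → orbit gensG (ι a) w ≡ true) (sym (ι-σ b))
        (run-in-orbit a b (skips b) ℕₚ.≤-refl ab)
    step′ (there (here refl)) b ab =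
      subst (λ w → orbit gensG (ι a) w ≡ true) (sym (ι-ρ b)) (G.orbit-step (there (here refl)) _ _ ab)

  data Near (b : Fin p) (x : Fin g) : Set where
    at      : x ≡ ι b → Near b x
    on-run  : ∀ j → j < skips b → x ≡ run b j → Near b x
    off-run : ∀ j → j < skips b → x ≡ τ (run b j) → Near b x

  NearOrbit : Fin p → Fin g → Set
  NearOrbit a x = ∃ λ b → orbit gensP a b ≡ true × Near b x

  σ-near : ∀ a b x → orbit gensP a b ≡ true → Near b x → NearOrbit a (σ x)
  σ-near a b x ab (at refl) with skips b in sk
  ... | zero  = σP b , P.orbit-step (here refl) _ _ ab ,
                  at (trans (sym (cong (λ j → iter j (σ ∘ τ) (σ (ι b))) sk)) (sym (ι-σ b)))
  ... | suc _ = b , ab , on-run 0 (subst (0 <_) (sym sk) (s≤s z≤n)) refl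
  σ-near a b x ab (on-run zero    _    refl) = b , ab , at (invσ _)
  σ-near a b x ab (on-run (suc j) j<sk refl) = b , ab , off-run j (ℕₚ.<⇒≤ j<sk) (invσ _)
  σ-near a b x ab (off-run j j<sk refl) with ℕₚ.m≤n⇒m<n∨m≡n j<sk
  ... | inj₁ j+1<sk = b , ab , on-run (suc j) j+1<sk refl
  ... | inj₂ j+1≡sk = σP b , P.orbit-step (here refl) _ _ ab ,
                        at (trans (cong (λ i → iter i (σ ∘ τ) (σ (ι b))) j+1≡sk) (sym (ι-σ b)))

  ρ-near : ∀ a b x → orbit gensP a b ≡ true → Near b x → NearOrbit a (ρ x)
  ρ-near a b x ab (at refl)             = ρP b , P.orbit-step (there (here refl)) _ _ ab , at (sym (ι-ρ b))
  ρ-near a b x ab (on-run j j<sk refl)  = b , ab , off-run j j<sk (ρ-outside _ (skipped b j j<sk))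
  ρ-near a b x ab (off-run j j<sk refl) =
    b , ab , on-run j j<sk (trans (ρ-outside _ (trans (A-τ _) (skipped b j j<sk))) (invτ _))

  orbit-ι⁻ : ∀ a b → orbit gensG (ι a) (ι b) ≡ true → orbit gensP a b ≡ true
  orbit-ι⁻ a b ab with G.orbit-induction (ι a) (NearOrbit a) (a , P.orbit-refl a , at refl) step′ (ι b) ab
    where
    step′ : ∀ {t} → t ∈ gensG → ∀ x → NearOrbit a x → NearOrbit a (t x)
    step′ (here refl)         x (c , ac , near) = σ-near a c x ac near
    step′ (there (here refl)) x (c , ac , near) = ρ-near a c x ac near
  ... | c , ac , at e            = subst (λ w → orbit gensP a w ≡ true) (ι-injective _ _ (sym e)) ac
  ... | c , ac , on-run j j<sk e  = ⊥-elim (not-¬ (ι-in b) (trans (cong A e) (skipped c j j<sk)))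
  ... | c , ac , off-run j j<sk e =
    ⊥-elim (not-¬ (ι-in b) (trans (cong A e) (trans (A-τ _) (skipped c j j<sk))))

  orbit-ι : ∀ a b → orbit gensP a b ≡ orbit gensG (ι a) (ι b)
  orbit-ι a b = bool-ext (orbit-ι⁺ a b) (orbit-ι⁻ a b)

vertexGens edgeGens : ∀ {m} → Gem m → List (Fin m → Fin m)
vertexGens G = τ₁ G ∷ τ₂ G ∷ []
edgeGens   G = τ₀ G ∷ τ₂ G ∷ []

switch : ∀ {m} → (Fin m → Bool) → (Fin m → Fin m) → (Fin m → Fin m) → Fin m → Fin m
switch C a b x = if C x then a x else b x

switch-involutive : ∀ {m} (C : Fin m → Bool) {a b : Fin m → Fin m} →
  (∀ x → C (a x) ≡ C x) → (∀ x → C (b x) ≡ C x) →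
  (∀ x → a (a x) ≡ x) → (∀ x → b (b x) ≡ x) →
  ∀ x → switch C a b (switch C a b x) ≡ x
switch-involutive C {a} {b} Ca Cb ia ib x with C x in Cx
... | true  = trans (if-cong (trans (Ca x) Cx)) (ia x)
... | false = trans (if-cong (trans (Cb x) Cx)) (ib x)

record RibbonSubgraph {g p} (G : Gem g) (P : Gem p) (C : Fin g → Bool) : Set where
  field
    ribbonG    : IsRibbon G
    ribbonP    : IsRibbon P
    closed₀    : ∀ x → C (τ₀ G x) ≡ C x
    closed₂    : ∀ x → C (τ₂ G x) ≡ C x
    ι          : Fin p → Fin g
    isSubgraph : IsSubgraph P G C ι

module SubgraphCounts {g p} {G : Gem g} {P : Gem p} {C : Fin g → Bool} (S : RibbonSubgraph G P C) where
  open RibbonSubgraph S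
  open IsRibbon
  open IsSubgraph isSubgraph

  ι-in : ∀ a → C (ι a) ≡ true
  ι-in a = Equivalence.from (image (ι a)) (a , refl)

  ι-onto : ∀ x → C x ≡ true → ∃ λ a → ι a ≡ x
  ι-onto x = Equivalence.to (image x)

  skips : Fin p → ℕ
  skips a = proj₁ (comm₁ a)

  module EdgeOrbits = SkippingOrbits (τ₀ G) (τ₂ G) (τ₂ G) C ι (τ₀ P) (τ₂ P) (λ _ → 0)
    (inv₀ ribbonG) (inv₂ ribbonG) (inv₂ ribbonG) (inv₀ ribbonP) (inv₂ ribbonP)
    (λ _ _ → refl) closed₂ ι-in injective comm₂ comm₀ (λ _ _ ())

  module VertexOrbits = SkippingOrbits (τ₁ G) (τ₂ G) (τ₂ G) C ι (τ₁ P) (τ₂ P) skips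
    (inv₁ ribbonG) (inv₂ ribbonG) (inv₂ ribbonG) (inv₁ ribbonP) (inv₂ ribbonP)
    (λ _ _ → refl) closed₂ ι-in injective comm₂
    (λ a → proj₁ (proj₂ (comm₁ a))) (λ a → proj₂ (proj₂ (comm₁ a)))

  #E-subgraph : #E P ≡ countF (λ x → isRoot (edgeGens G) x ∧ C x)
  #E-subgraph =
    numOrbits-transport EdgeOrbits.invP EdgeOrbits.invG ι C ι-in cover C-invariant EdgeOrbits.orbit-ι
    where
    cover : ∀ x → C x ≡ true → ∃ λ a → orbit (edgeGens G) x (ι a) ≡ true
    cover x Cx = let (a , ιa≡x) = ι-onto x Cx in
      a , subst (λ w → orbit (edgeGens G) x w ≡ true) (sym ιa≡x) (EdgeOrbits.G.orbit-refl x)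
    C-invariant : ∀ x y → orbit (edgeGens G) x y ≡ true → C x ≡ true → C y ≡ true
    C-invariant x y xy Cx = EdgeOrbits.G.orbit-induction x (λ w → C w ≡ true) Cx closed y xy
      where
      closed : ∀ {t} → t ∈ edgeGens G → ∀ z → C z ≡ true → C (t z) ≡ true
      closed (here refl)         z Cz = trans (closed₀ z) Cz
      closed (there (here refl)) z Cz = trans (closed₂ z) Cz

  numOrbits-meeting : ∀ {gensP : List (Fin p → Fin p)} {gensG : List (Fin g → Fin g)} →
    Involutions gensP → (invG : Involutions gensG) →
    (∀ a b → orbit gensP a b ≡ orbit gensG (ι a) (ι b)) →
    numOrbits gensP ≡ countF (λ x → isRoot gensG x ∧ meets gensG C x)
  numOrbits-meeting {gensG = gensG} invP invG ι-orbit =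
    numOrbits-transport invP invG ι (meets gensG C)
      (λ a → meets-intro C (ι a) (ι a) (orbit-refl (ι a)) (ι-in a)) cover (meets-invariant C) ι-orbit
    where
    open Orbits gensG invG
    cover : ∀ x → meets gensG C x ≡ true → ∃ λ a → orbit gensG x (ι a) ≡ true
    cover x h = let (z , xz , Cz) = meets⁻ C x h ; (a , ιa≡z) = ι-onto z Cz in
      a , subst (λ w → orbit gensG x w ≡ true) (sym ιa≡z) xz

  #V-subgraph : #V P ≡ countF (λ x → isRoot (vertexGens G) x ∧ meets (vertexGens G) C x)
  #V-subgraph = numOrbits-meeting VertexOrbits.invP VertexOrbits.invG VertexOrbits.orbit-ι

  -- ρ is τ₂ of the partial dual G^C, or τ₀ of the partial dual with respect to the complement of C
  module _ (ρ : Fin g → Fin g) (ρ-switch : ∀ x → ρ x ≡ switch C (τ₀ G) (τ₂ G) x) where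

    ρ-inside : ∀ x → C x ≡ true → ρ x ≡ τ₀ G x
    ρ-inside x Cx = trans (ρ-switch x) (if-cong Cx)

    ρ-outside : ∀ x → C x ≡ false → ρ x ≡ τ₂ G x
    ρ-outside x Cx = trans (ρ-switch x) (if-cong Cx)

    ρ-involutive : ∀ x → ρ (ρ x) ≡ x
    ρ-involutive x =
      trans (trans (ρ-switch (ρ x)) (cong (switch C (τ₀ G) (τ₂ G)) (ρ-switch x)))
            (switch-involutive C closed₀ closed₂ (inv₀ ribbonG) (inv₂ ribbonG) x)

    module FaceOrbits = SkippingOrbits (τ₁ G) ρ (τ₂ G) C ι (τ₁ P) (τ₀ P) skips
      (inv₁ ribbonG) ρ-involutive (inv₂ ribbonG) (inv₁ ribbonP) (inv₀ ribbonP)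
      ρ-outside closed₂ ι-in injective (λ a → trans (comm₀ a) (sym (ρ-inside (ι a) (ι-in a))))
      (λ a → proj₁ (proj₂ (comm₁ a))) (λ a → proj₂ (proj₂ (comm₁ a)))

    -- the ⟨τ₁, ρ⟩-orbits meeting C are the faces of P; the others are the vertices of G avoiding C
    numOrbits-τ₁-ρ : numOrbits (τ₁ G ∷ ρ ∷ []) ≡
      #F P + countF (λ x → isRoot (vertexGens G) x ∧ not (meets (vertexGens G) C x))
    numOrbits-τ₁-ρ = trans (countF-split _ (meets (τ₁ G ∷ ρ ∷ []) C)) (cong₂ _+_ faces avoiding)
      where
      faces : countF (λ x → isRoot (τ₁ G ∷ ρ ∷ []) x ∧ meets (τ₁ G ∷ ρ ∷ []) C x) ≡ #F P
      faces = sym (trans (numOrbits-swap (inv₀ ribbonP) (inv₁ ribbonP))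
                         (numOrbits-meeting FaceOrbits.invP FaceOrbits.invG FaceOrbits.orbit-ι))

      ρ-as-τ₂ : ActsWithin (λ y → C y ≡ false) (τ₁ G ∷ ρ ∷ []) (vertexGens G)
      ρ-as-τ₂ (here refl)         y _  = _ , here refl , refl
      ρ-as-τ₂ (there (here refl)) y Cy = _ , there (here refl) , ρ-outside y Cy

      τ₂-as-ρ : ActsWithin (λ y → C y ≡ false) (vertexGens G) (τ₁ G ∷ ρ ∷ [])
      τ₂-as-ρ (here refl)         y _  = _ , here refl , refl
      τ₂-as-ρ (there (here refl)) y Cy = _ , there (here refl) , sym (ρ-outside y Cy)

      avoiding : countF (λ x → isRoot (τ₁ G ∷ ρ ∷ []) x ∧ not (meets (τ₁ G ∷ ρ ∷ []) C x)) ≡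
                 countF (λ x → isRoot (vertexGens G) x ∧ not (meets (vertexGens G) C x))
      avoiding = countF-avoiding-cong FaceOrbits.invG VertexOrbits.invG C ρ-as-τ₂ τ₂-as-ρ

switch-acts : ∀ {m} {L : List (Fin m → Fin m)} (C : Fin m → Bool) {a b : Fin m → Fin m} →
  a ∈ L → b ∈ L → ∀ y → ∃ λ t → t ∈ L × switch C a b y ≡ t y
switch-acts C a∈ b∈ y with C y
... | true  = _ , a∈ , refl
... | false = _ , b∈ , refl

unswitch-acts : ∀ {m} {L : List (Fin m → Fin m)} (C : Fin m → Bool) {a b : Fin m → Fin m} →
  switch C a b ∈ L → switch C b a ∈ L → ∀ y → ∃ λ t → t ∈ L × a y ≡ t y
unswitch-acts C ab∈ ba∈ y with C y in Cy
... | true  = _ , ab∈ , sym (if-cong Cy)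
... | false = _ , ba∈ , sym (if-cong Cy)

module PartialDualInvariants {g} {G : Gem g} (ribbon : IsRibbon G) (C : Fin g → Bool)
  (closed₀ : ∀ x → C (τ₀ G x) ≡ C x) (closed₂ : ∀ x → C (τ₂ G x) ≡ C x) where
  open IsRibbon ribbon

  G^C : Gem g
  G^C = partialDual G C

  τ₀-dual-involutive : ∀ x → τ₀ G^C (τ₀ G^C x) ≡ x
  τ₀-dual-involutive = switch-involutive C closed₂ closed₀ inv₂ inv₀

  τ₂-dual-involutive : ∀ x → τ₂ G^C (τ₂ G^C x) ≡ x
  τ₂-dual-involutive = switch-involutive C closed₀ closed₂ inv₀ inv₂

  #E-partialDual : #E G^C ≡ #E G
  #E-partialDual = numOrbits-cong (involutions₂ τ₀-dual-involutive τ₂-dual-involutive)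
    (involutions₂ inv₀ inv₂) dual-within within-dual
    where
    dual-within : ActsAsSomeOf (edgeGens G^C) (edgeGens G)
    dual-within (here refl)         y _ = switch-acts C (there (here refl)) (here refl) y
    dual-within (there (here refl)) y _ = switch-acts C (here refl) (there (here refl)) y
    within-dual : ActsAsSomeOf (edgeGens G) (edgeGens G^C)
    within-dual (here refl)         y _ = unswitch-acts C (there (here refl)) (here refl) y
    within-dual (there (here refl)) y _ = unswitch-acts C (here refl) (there (here refl)) y

  #K-partialDual : #K G^C ≡ #K G
  #K-partialDual = numOrbits-cong (involutions₃ τ₀-dual-involutive inv₁ τ₂-dual-involutive)
    (involutions₃ inv₀ inv₁ inv₂) dual-within within-dual
    where
    dual-within : ActsAsSomeOf (τ₀ G^C ∷ τ₁ G^C ∷ τ₂ G^C ∷ []) (τ₀ G ∷ τ₁ G ∷ τ₂ G ∷ [])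
    dual-within (here refl)                 y _ = switch-acts C (there (there (here refl))) (here refl) y
    dual-within (there (here refl))         y _ = _ , there (here refl) , refl
    dual-within (there (there (here refl))) y _ = switch-acts C (here refl) (there (there (here refl))) y
    within-dual : ActsAsSomeOf (τ₀ G ∷ τ₁ G ∷ τ₂ G ∷ []) (τ₀ G^C ∷ τ₁ G^C ∷ τ₂ G^C ∷ [])
    within-dual (here refl)                 y _ = unswitch-acts C (there (there (here refl))) (here refl) y
    within-dual (there (here refl))         y _ = _ , there (here refl) , refl
    within-dual (there (there (here refl))) y _ = unswitch-acts C (here refl) (there (there (here refl))) y

countF-meets-split : ∀ {m} {gens : List (Fin m → Fin m)} → Involutions gens →
  (A B : Fin m → Bool) → (∀ x → A x ∨ B x ≡ true) →
  countF (λ x → isRoot gens x ∧ meets gens A x) ≡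
  countF (λ x → isRoot gens x ∧ meets gens A x ∧ meets gens B x) +
  countF (λ x → isRoot gens x ∧ not (meets gens B x))
countF-meets-split {gens = gens} inv A B cover =
  trans (countF-split _ (meets gens B))
        (cong₂ _+_ (countF-cong λ x → ∧-assoc (isRoot gens x) _ _) (countF-cong only-A))
  where
  open Orbits gens inv
  only-A : ∀ x → (isRoot gens x ∧ meets gens A x) ∧ not (meets gens B x) ≡
                 isRoot gens x ∧ not (meets gens B x)
  only-A x with meets gens B x in B-meets
  ... | true  = trans (∧-zeroʳ _) (sym (∧-zeroʳ _))
  ... | false with ∨-true⁻ (A x) (cover x)
  ...   | inj₁ Ax = trans (cong (λ b → (isRoot gens x ∧ b) ∧ true) (meets-intro A x x (orbit-refl x) Ax))
                          (∧-assoc (isRoot gens x) true true)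
  ...   | inj₂ Bx = ⊥-elim (not-¬ (meets-intro B x x (orbit-refl x) Bx) B-meets)

χ-via : ∀ {m} (G : Gem m) {v e f} → #V G ≡ v → #E G ≡ e → #F G ≡ f →
  χ G ≡ (+ v ℤ.- + e) ℤ.+ + f
χ-via G refl refl refl = refl

-- a, b: vertices avoiding E(P), resp. E(Q); s: vertices shared by P and Q
euler-partialDual : ∀ (s a b eP eQ fP fQ : ℕ) →
  (+ (fP + a) ℤ.- + (eP + eQ)) ℤ.+ + (fQ + b) ≡
  (((+ (s + b) ℤ.- + eP) ℤ.+ + fP) ℤ.+ ((+ (s + a) ℤ.- + eQ) ℤ.+ + fQ)) ℤ.- + (2 ℕ.* s)
euler-partialDual s a b eP eQ fP fQ
  rewrite ℤₚ.pos-+ fP a | ℤₚ.pos-+ eP eQ | ℤₚ.pos-+ fQ b | ℤₚ.pos-+ s b | ℤₚ.pos-+ s a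
        | ℕₚ.+-identityʳ s | ℤₚ.pos-+ s s
  = identity (+ s) (+ a) (+ b) (+ eP) (+ eQ) (+ fP) (+ fQ)
  where
  identity : ∀ (s a b eP eQ fP fQ : ℤ) →
    ((fP ℤ.+ a) ℤ.- (eP ℤ.+ eQ)) ℤ.+ (fQ ℤ.+ b) ≡
    ((((s ℤ.+ b) ℤ.- eP) ℤ.+ fP) ℤ.+ (((s ℤ.+ a) ℤ.- eQ) ℤ.+ fQ)) ℤ.- (s ℤ.+ s)
  identity = solve-∀

γ-connected : ∀ {m} (X : Gem m) → Connected X → γ X ≡ + 2 ℤ.- χ X
γ-connected X connected = cong (λ k → + (2 ℕ.* k) ℤ.- χ X) connected

genus-excess : ∀ (χP χQ : ℤ) k →
  + 2 ℤ.- ((χP ℤ.+ χQ) ℤ.- + (2 ℕ.* suc k)) ≡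
  ((+ 2 ℤ.- χP) ℤ.+ (+ 2 ℤ.- χQ)) ℤ.+ + (2 ℕ.* k)
genus-excess χP χQ k =
  trans (cong (λ l → + 2 ℤ.- ((χP ℤ.+ χQ) ℤ.- l))
              (trans (cong +_ (ℕₚ.*-suc 2 k)) (ℤₚ.pos-+ 2 (2 ℕ.* k))))
        (identity χP χQ (+ (2 ℕ.* k)))
  where
  identity : ∀ (χP χQ l : ℤ) →
    + 2 ℤ.- ((χP ℤ.+ χQ) ℤ.- (+ 2 ℤ.+ l)) ≡ ((+ 2 ℤ.- χP) ℤ.+ (+ 2 ℤ.- χQ)) ℤ.+ l
  identity = solve-∀

suc-suc-of-≥2 : ∀ {n} → 2 ≤ n → ∃ λ k → n ≡ suc (suc k)
suc-suc-of-≥2 (s≤s (s≤s {n = k} _)) = k , refl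

i<i+1+k : ∀ i k → i ℤ.< i ℤ.+ + suc k
i<i+1+k i k = subst (ℤ._< i ℤ.+ + suc k) (ℤₚ.+-identityʳ i) (ℤₚ.+-monoʳ-< i (ℤ.+<+ (s≤s z≤n)))

module PartialDualOfSum {g p q} {G : Gem g} {P : Gem p} {Q : Gem q} {A B : Fin g → Bool}
  (SP : RibbonSubgraph G P A) (SQ : RibbonSubgraph G Q B) (B-complement : ∀ x → B x ≡ not (A x)) where
  open RibbonSubgraph SP using (ribbonG; closed₀; closed₂)
  open IsRibbon ribbonG
  module P = SubgraphCounts SP
  module Q = SubgraphCounts SQ
  open PartialDualInvariants ribbonG A closed₀ closed₂ public

  avoiding : (Fin g → Bool) → ℕ
  avoiding C = countF (λ x → isRoot (vertexGens G) x ∧ not (meets (vertexGens G) C x))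

  shared : ℕ
  shared = countF (λ x → isRoot (vertexGens G) x ∧ meets (vertexGens G) A x ∧ meets (vertexGens G) B x)

  A∨B : ∀ x → A x ∨ B x ≡ true
  A∨B x = subst (λ b → A x ∨ b ≡ true) (sym (B-complement x)) (∨-inverseʳ (A x))

  #V-P : #V P ≡ shared + avoiding B
  #V-P = trans P.#V-subgraph (countF-meets-split P.VertexOrbits.invG A B A∨B)

  #V-Q : #V Q ≡ shared + avoiding A
  #V-Q = trans Q.#V-subgraph
    (trans (countF-meets-split P.VertexOrbits.invG B A (λ x → trans (∨-comm (B x) (A x)) (A∨B x)))
           (cong (_+ avoiding A) (countF-cong λ x →
              cong (isRoot (vertexGens G) x ∧_) (∧-comm (meets (vertexGens G) B x) _))))

  #E-G : #E G ≡ #E P + #E Q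
  #E-G = trans (countF-split (isRoot (edgeGens G)) A)
    (sym (cong₂ _+_ P.#E-subgraph
      (trans Q.#E-subgraph (countF-cong λ x → cong (isRoot (edgeGens G) x ∧_) (B-complement x)))))

  #V-partialDual : #V G^C ≡ #F P + avoiding A
  #V-partialDual = P.numOrbits-τ₁-ρ (τ₂ G^C) (λ _ → refl)

  #F-partialDual : #F G^C ≡ #F Q + avoiding B
  #F-partialDual =
    trans (numOrbits-swap τ₀-dual-involutive inv₁) (Q.numOrbits-τ₁-ρ (τ₀ G^C) τ₀-switch)
    where
    τ₀-switch : ∀ x → τ₀ G^C x ≡ switch B (τ₀ G) (τ₂ G) x
    τ₀-switch x = trans (sym (if-not (A x))) (if-cong (sym (B-complement x)))

  χ-partialDual : χ G^C ≡ (χ P ℤ.+ χ Q) ℤ.- + (2 ℕ.* shared)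
  χ-partialDual =
    trans (χ-via G^C #V-partialDual (trans #E-partialDual #E-G) #F-partialDual)
      (trans (euler-partialDual shared (avoiding A) (avoiding B) (#E P) (#E Q) (#F P) (#F Q))
             (sym (cong₂ (λ χP χQ → (χP ℤ.+ χQ) ℤ.- + (2 ℕ.* shared))
                         (χ-via P #V-P refl refl) (χ-via Q #V-Q refl refl))))

  shared-comm : shared ≡
    countF (λ x → isRoot (vertexGens G) x ∧ meets (vertexGens G) B x ∧ meets (vertexGens G) A x)
  shared-comm = countF-cong λ x →
    cong (isRoot (vertexGens G) x ∧_) (∧-comm (meets (vertexGens G) A x) _)

  γ-partialDual : Connected G → Connected P → Connected Q → ∀ k → shared ≡ suc k →
    γ G^C ≡ (γ P ℤ.+ γ Q) ℤ.+ + (2 ℕ.* k)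
  γ-partialDual connG connP connQ k shared≡1+k =
    trans (γ-connected G^C (trans #K-partialDual connG))
      (trans (cong (λ c → + 2 ℤ.- c) χ-G^C)
        (trans (genus-excess (χ P) (χ Q) k)
          (sym (cong₂ (λ γP γQ → (γP ℤ.+ γQ) ℤ.+ + (2 ℕ.* k))
                      (γ-connected P connP) (γ-connected Q connQ)))))
    where
    χ-G^C : χ G^C ≡ (χ P ℤ.+ χ Q) ℤ.- + (2 ℕ.* suc k)
    χ-G^C = trans χ-partialDual (cong (λ s → (χ P ℤ.+ χ Q) ℤ.- + (2 ℕ.* s)) shared≡1+k)

module NSumDuals {n g p q} {G : Gem g} {P : Gem p} {Q : Gem q} {inP : Fin g → Bool}
  (N : IsNSum n G P Q inP) where
  open IsNSum N

  E-P : RibbonSubgraph G P inP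
  E-P = record { ribbonG = ribbonG ; ribbonP = ribbonP ; closed₀ = closed₀ ; closed₂ = closed₂
               ; ι = ιP ; isSubgraph = subP }

  E-Q : RibbonSubgraph G Q (not ∘ inP)
  E-Q = record { ribbonG = ribbonG ; ribbonP = ribbonQ
               ; closed₀ = cong not ∘ closed₀ ; closed₂ = cong not ∘ closed₂
               ; ι = ιQ ; isSubgraph = subQ }

  module DualP = PartialDualOfSum E-P E-Q (λ _ → refl)
  module DualQ = PartialDualOfSum E-Q E-P (λ x → sym (not-involutive (inP x)))

  χ-P : χ (partialDual G inP) ≡ (χ P ℤ.+ χ Q) ℤ.- + (2 ℕ.* n)
  χ-P = trans DualP.χ-partialDual (cong (λ s → (χ P ℤ.+ χ Q) ℤ.- + (2 ℕ.* s)) shared)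

  χ-Q≡χ-P : χ (partialDual G (not ∘ inP)) ≡ χ (partialDual G inP)
  χ-Q≡χ-P = trans DualQ.χ-partialDual
    (trans (cong₂ (λ c s → c ℤ.- + (2 ℕ.* s))
                  (ℤₚ.+-comm (χ Q) (χ P)) (trans (sym DualP.shared-comm) shared))
           (sym χ-P))

  γ-Q≡γ-P : γ (partialDual G (not ∘ inP)) ≡ γ (partialDual G inP)
  γ-Q≡γ-P = trans (γ-connected DualQ.G^C (trans DualQ.#K-partialDual connG))
    (trans (cong (λ c → + 2 ℤ.- c) χ-Q≡χ-P)
           (sym (γ-connected DualP.G^C (trans DualP.#K-partialDual connG))))

  γ-P : ∀ k → n ≡ suc k → γ (partialDual G inP) ≡ (γ P ℤ.+ γ Q) ℤ.+ + (2 ℕ.* k)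
  γ-P k n≡1+k = DualP.γ-partialDual connG connP connQ k (trans shared n≡1+k)

lemma1 : ∀ {g p q : ℕ} (n : ℕ) (G : Gem g) (P : Gem p) (Q : Gem q) (inP : Fin g → Bool)
           → IsNSum n G P Q inP
           → (χ (partialDual G (not ∘ inP)) ≡ χ (partialDual G inP)
               × χ (partialDual G inP) ≡ (χ P ℤ.+ χ Q) ℤ.- + (2 ℕ.* n))
           × (n ≡ 1 → γ (partialDual G (not ∘ inP)) ≡ γ (partialDual G inP)
               × γ (partialDual G inP) ≡ γ P ℤ.+ γ Q)
           × (2 ≤ n → γ (partialDual G (not ∘ inP)) ≡ γ (partialDual G inP)
               × γ P ℤ.+ γ Q ℤ.< γ (partialDual G inP))
lemma1 n G P Q inP N = (χ-Q≡χ-P , χ-P) , genus-one , genus-many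
  where
  open NSumDuals N

  genus-one : n ≡ 1 → γ (partialDual G (not ∘ inP)) ≡ γ (partialDual G inP)
                    × γ (partialDual G inP) ≡ γ P ℤ.+ γ Q
  genus-one n≡1 = γ-Q≡γ-P , trans (γ-P 0 n≡1) (ℤₚ.+-identityʳ _)

  genus-many : 2 ≤ n → γ (partialDual G (not ∘ inP)) ≡ γ (partialDual G inP)
                     × γ P ℤ.+ γ Q ℤ.< γ (partialDual G inP)
  genus-many 2≤n = let (k , n≡2+k) = suc-suc-of-≥2 2≤n in
    γ-Q≡γ-P , subst (γ P ℤ.+ γ Q ℤ.<_) (sym (γ-P (suc k) n≡2+k)) (i<i+1+k _ _)
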